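{- Let $n\ge 2$, let $t_n$ be the smallest integer $t$ with $\frac1t+\frac1{t+1}+\dots+\frac1{n-1}\le 1$, and for $k\in\{1,\dots,n\}$ let \[r_{k,n}=\frac{t_n-1}{n}\left(\sum_{i=t_n}^{n-k+1}\frac{\binom{n-k}{i-1}}{\binom{n-1}{i-1}}\frac{1}{i-1}+\frac{1}{n-1}\right).\] Then the sequence $(r_{k,n})_{k=1}^n$ is non-increasing in $k$.
   Context: An empty sum is $0$, and $\binom{a}{b}=0$ when $b>a$. (The quantity $r_{k,n}$ is the probability that the optimal secretary algorithm with threshold $t_n$ selects the $k$-th best of $n$ candidates arriving in uniformly random order.) -}

module Defs where

open import Data.Nat as ℕ using (ℕ; zero; suc; _∸_)
open import Data.Nat.Combinatorics using (_C_)
open import Data.Integer using (+_)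
open import Data.Rational using (ℚ; _/_; 0ℚ; 1ℚ; _+_; _*_)

-- a / b as a rational, with the convention a / 0 = 0 (only used where
-- the denominator is nonzero or multiplied by a zero prefactor)
frac : ℕ → ℕ → ℚ
frac a zero    = 0ℚ
frac a (suc b) = (+ a) / suc b

inv : ℕ → ℚ
inv a = frac 1 a

toℚ : ℕ → ℚ
toℚ a = (+ a) / 1

-- sumFT f a b = f a + f (a+1) + ... + f b   (empty sum = 0 when b < a)
sumCount : (ℕ → ℚ) → ℕ → ℕ → ℚ
sumCount f a zero      = 0ℚ
sumCount f a (suc len) = f a + sumCount f (suc a) len

sumFT : (ℕ → ℚ) → ℕ → ℕ → ℚ
sumFT f a b = sumCount f a (suc b ∸ a)

H : ℕ → ℕ → ℚ
H t n = sumFT inv t (n ∸ 1)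

IsThreshold : ℕ → ℕ → Set
IsThreshold n t =
  (1 ℕ.≤ t) × (H t n Data.Rational.≤ 1ℚ) ×
  ((s : ℕ) → 1 ℕ.≤ s → H s n Data.Rational.≤ 1ℚ → t ℕ.≤ s)
  where open import Data.Product using (_×_)

r : ℕ → ℕ → ℕ → ℚ
r t n k =
  frac (t ∸ 1) n *
  (sumFT (λ i → frac ((n ∸ k) C (i ∸ 1)) ((n ∸ 1) C (i ∸ 1)) * inv (i ∸ 1)) t (suc (n ∸ k))
   + inv (n ∸ 1))

module Submission where

-- r_{k,n} is (t-1)/n times a sum of nonnegative terms
-- C(n-k, i-1) / C(n-1, i-1) / (i-1) over t ≤ i ≤ n-k+1.  Passing from k to
-- k+1 decreases every binomial C(n-k, i-1) and drops the last index, so the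
-- sum can only shrink.

open import Defs
open import Data.Nat using (ℕ; suc; _≤_; _<_)
open import Data.Rational using () renaming (_≤_ to _≤ℚ_)

import Data.Nat as ℕ
import Data.Nat.Properties as ℕ
open import Data.Nat.Combinatorics using (_C_; nCk+nC[k+1]≡[n+1]C[k+1])
import Data.Integer as ℤ
import Data.Integer.Properties as ℤ
open import Data.Rational using (ℚ; 0ℚ; NonNegative; _*_; toℚᵘ; fromℚᵘ)
import Data.Rational.Properties as ℚ
import Data.Rational.Unnormalised as ℚᵘ
import Data.Rational.Unnormalised.Properties as ℚᵘ
open import Relation.Binary.PropositionalEquality using (_≡_; refl; subst)

C-monoˡ-≤ : ∀ m j → m C j ≤ suc m C j
C-monoˡ-≤ m ℕ.zero    = ℕ.≤-refl
C-monoˡ-≤ m (suc j) =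
  subst (m C suc j ≤_) (nCk+nC[k+1]≡[n+1]C[k+1] m j) (ℕ.m≤n+m _ _)

frac-nonNeg : ∀ a d → NonNegative (frac a d)
frac-nonNeg a ℕ.zero  = _
frac-nonNeg a (suc d) = ℚ.normalize-nonNeg a (suc d)

frac-monoˡ-≤ : ∀ {a b} d → a ≤ b → frac a d ≤ℚ frac b d
frac-monoˡ-≤ ℕ.zero a≤b = ℚ.≤-refl
frac-monoˡ-≤ {a} {b} (suc d) a≤b = ℚ.toℚᵘ-cancel-≤ (begin
  toℚᵘ (fromℚᵘ (ℚᵘ.mkℚᵘ (ℤ.+ a) d)) ≃⟨ ℚ.toℚᵘ-fromℚᵘ _ ⟩
  ℚᵘ.mkℚᵘ (ℤ.+ a) d                    ≤⟨ ℚᵘ.*≤* (ℤ.*-monoʳ-≤-nonNeg (ℤ.+ suc d) (ℤ.+≤+ a≤b)) ⟩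
  ℚᵘ.mkℚᵘ (ℤ.+ b) d                    ≃⟨ ℚ.toℚᵘ-fromℚᵘ _ ⟨
  toℚᵘ (fromℚᵘ (ℚᵘ.mkℚᵘ (ℤ.+ b) d)) ∎)
  where open ℚᵘ.≤-Reasoning

sumCount-nonNeg : ∀ f → (∀ i → 0ℚ ≤ℚ f i) → ∀ a len → 0ℚ ≤ℚ sumCount f a len
sumCount-nonNeg f 0≤f a ℕ.zero    = ℚ.≤-refl
sumCount-nonNeg f 0≤f a (suc len) = ℚ.+-mono-≤ (0≤f a) (sumCount-nonNeg f 0≤f (suc a) len)

sumCount-mono-≤ : ∀ {f g} → (∀ i → f i ≤ℚ g i) → ∀ a {len len'} → len ≤ len' →
  (∀ i → 0ℚ ≤ℚ g i) → sumCount f a len ≤ℚ sumCount g a len'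
sumCount-mono-≤ f≤g a {len' = len'} ℕ.z≤n 0≤g = sumCount-nonNeg _ 0≤g a len'
sumCount-mono-≤ f≤g a (ℕ.s≤s len≤len') 0≤g =
  ℚ.+-mono-≤ (f≤g a) (sumCount-mono-≤ f≤g (suc a) len≤len' 0≤g)

sumFT-mono-≤ : ∀ {f g} → (∀ i → f i ≤ℚ g i) → (∀ i → 0ℚ ≤ℚ g i) →
  ∀ a {b b'} → b ≤ b' → sumFT f a b ≤ℚ sumFT g a b'
sumFT-mono-≤ f≤g 0≤g a b≤b' =
  sumCount-mono-≤ f≤g a (ℕ.∸-monoˡ-≤ a (ℕ.s≤s b≤b')) 0≤g

rSummand : ℕ → ℕ → ℕ → ℚ
rSummand n m i = frac (m C (i ℕ.∸ 1)) ((n ℕ.∸ 1) C (i ℕ.∸ 1)) * inv (i ℕ.∸ 1)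

rSummand-nonNeg : ∀ n m i → 0ℚ ≤ℚ rSummand n m i
rSummand-nonNeg n m i = ℚ.nonNegative⁻¹ (rSummand n m i)
  {{ℚ.nonNeg*nonNeg⇒nonNeg (frac a d) {{frac-nonNeg a d}} (inv (i ℕ.∸ 1)) {{frac-nonNeg 1 (i ℕ.∸ 1)}}}}
  where
  a = m C (i ℕ.∸ 1)
  d = (n ℕ.∸ 1) C (i ℕ.∸ 1)

rSummand-monoˡ-≤ : ∀ n m i → rSummand n m i ≤ℚ rSummand n (suc m) i
rSummand-monoˡ-≤ n m i = ℚ.*-monoʳ-≤-nonNeg (inv (i ℕ.∸ 1)) {{frac-nonNeg 1 (i ℕ.∸ 1)}}
  (frac-monoˡ-≤ ((n ℕ.∸ 1) C (i ℕ.∸ 1)) (C-monoˡ-≤ m (i ℕ.∸ 1)))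

n∸k≡1+n∸[1+k] : ∀ {n k} → k < n → n ℕ.∸ k ≡ suc (n ℕ.∸ suc k)
n∸k≡1+n∸[1+k] {suc n} {ℕ.zero} _ = refl
n∸k≡1+n∸[1+k] {suc n} {suc k} (ℕ.s≤s k<n) = n∸k≡1+n∸[1+k] k<n

r-antitone : ∀ t n k → k < n → r t n (suc k) ≤ℚ r t n k
r-antitone t n k k<n =
  ℚ.*-monoˡ-≤-nonNeg (frac (t ℕ.∸ 1) n) {{frac-nonNeg (t ℕ.∸ 1) n}}
    (ℚ.+-monoˡ-≤ (inv (n ℕ.∸ 1)) sum≤sum)
  where
  m = n ℕ.∸ suc k
  sum≤sum : sumFT (rSummand n m) t (suc m) ≤ℚ sumFT (rSummand n (n ℕ.∸ k)) t (suc (n ℕ.∸ k))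
  sum≤sum rewrite n∸k≡1+n∸[1+k] k<n =
    sumFT-mono-≤ (rSummand-monoˡ-≤ n m) (rSummand-nonNeg n (suc m)) t (ℕ.n≤1+n _)

corollary4 : (n t : ℕ) → 2 ≤ n → IsThreshold n t →
    (k : ℕ) → 1 ≤ k → k < n → r t n (suc k) ≤ℚ r t n k
corollary4 n t _ _ k _ k<n = r-antitone t n k k<n
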